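{- If $M\in\mathbb Z^{m\times n}$ is minimum, then its columns are in increasing lexicographic order: $M^1\le M^2\le\cdots\le M^n$, where $M^j$ is the $j$-th column.
   Context: On $\mathbb Z^m$ and $\mathbb Z^n$ use the lexicographic order $\le$; the row-lex ordering on $\mathbb Z^{m\times n}$ is its lexicographic extension, viewing a matrix as the sequence of its rows. Two matrices are H-equivalent if one is obtained from the other by permuting and negating rows and columns. $M$ is minimum if it is the row-lex smallest element of its H-equivalence class. -}

module Defs where

open import Data.Nat using (ℕ)
open import Data.Fin using (Fin; _<_)
open import Data.Integer using (ℤ; -_) renaming (_<_ to _<ℤ_)
open import Data.Product using (Σ; _×_)
open import Data.Sum using (_⊎_)
open import Data.Bool using (Bool; true; false)
open import Relation.Binary.PropositionalEquality using (_≡_)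
open import Function.Bundles using (_↔_; Inverse)

LexLt : {A : Set} (_≈_ : A → A → Set) (_≺_ : A → A → Set) {k : ℕ} →
        (Fin k → A) → (Fin k → A) → Set
LexLt _≈_ _≺_ {k} u v =
  Σ (Fin k) λ i → ((j : Fin k) → j < i → u j ≈ v j) × (u i ≺ v i)

LexLe : {A : Set} (_≈_ : A → A → Set) (_≺_ : A → A → Set) {k : ℕ} →
        (Fin k → A) → (Fin k → A) → Set
LexLe _≈_ _≺_ {k} u v = ((i : Fin k) → u i ≈ v i) ⊎ LexLt _≈_ _≺_ u v

Vecℤ : ℕ → Set
Vecℤ k = Fin k → ℤ

_≡v_ : {k : ℕ} → Vecℤ k → Vecℤ k → Set
u ≡v v = (i : Fin _) → u i ≡ v i

_<lex_ : {k : ℕ} → Vecℤ k → Vecℤ k → Set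
_<lex_ = LexLt _≡_ _<ℤ_

_≤lex_ : {k : ℕ} → Vecℤ k → Vecℤ k → Set
_≤lex_ = LexLe _≡_ _<ℤ_

Matrix : ℕ → ℕ → Set
Matrix m n = Fin m → Fin n → ℤ

col : {m n : ℕ} → Matrix m n → Fin n → Vecℤ m
col M j i = M i j

_≤rowlex_ : {m n : ℕ} → Matrix m n → Matrix m n → Set
_≤rowlex_ = LexLe _≡v_ _<lex_

sign : Bool → ℤ → ℤ
sign true  x = - x
sign false x = x

act : {m n : ℕ} → (Fin m ↔ Fin m) → (Fin n ↔ Fin n) →
      (Fin m → Bool) → (Fin n → Bool) → Matrix m n → Matrix m n
act σ τ r c M i j = sign (r i) (sign (c j) (M (Inverse.to σ i) (Inverse.to τ j)))

HEquiv : {m n : ℕ} → Matrix m n → Matrix m n → Set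
HEquiv {m} {n} M N =
  Σ (Fin m ↔ Fin m) λ σ → Σ (Fin n ↔ Fin n) λ τ →
  Σ (Fin m → Bool) λ r → Σ (Fin n → Bool) λ c →
  ((i : Fin m) (j : Fin n) → N i j ≡ act σ τ r c M i j)

Minimum : {m n : ℕ} → Matrix m n → Set
Minimum M = ∀ N → HEquiv M N → M ≤rowlex N

{-# OPTIONS --safe #-}
-- If some column k lies lexicographically below an earlier column j, let i be the first row
-- where they differ.  Swapping columns j and k leaves the rows above i unchanged (there the two
-- columns agree) and makes row i lexicographically smaller (its first change is at position j,
-- where M i j is replaced by the smaller M i k).  The swapped matrix is H-equivalent to M and
-- row-lex smaller, contradicting minimality.
module Submission where

open import Defs
open import Data.Nat using (ℕ; zero; suc; s≤s)
open import Data.Fin using (Fin; _≤_; _<_; zero; suc; _≟_)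
open import Data.Fin.Properties using (<-cmp; <⇒≢)
open import Data.Nat.Properties using (<-≤-trans)
import Data.Fin.Permutation as Perm
open import Data.Fin.Permutation.Components using (transpose)
open import Data.Integer using (ℤ) renaming (_<_ to _<ℤ_)
import Data.Integer.Properties as ℤ
open import Data.Vec.Functional using (tail)
open import Data.Vec.Functional.Relation.Binary.Pointwise using (Pointwise)
open import Data.Product using (_,_)
open import Data.Sum using (_⊎_; inj₁; inj₂)
open import Data.Bool using (false)
open import Data.Empty using (⊥-elim)
open import Function using (_∘_)
open import Relation.Nullary using (¬_; yes; no)
open import Relation.Nullary.Decidable using (dec-true; dec-false)
open import Relation.Binary.Definitions
  using (Symmetric; Irreflexive; Asymmetric; Trichotomous; tri<; tri≈; tri>)
open import Relation.Binary.PropositionalEquality using (_≡_; _≢_; _≗_; refl; sym; cong)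

module _ {A : Set} {_≈_ _≺_ : A → A → Set} where

  LexLt-head : {k : ℕ} {u v : Fin (suc k) → A} → u zero ≺ v zero → LexLt _≈_ _≺_ u v
  LexLt-head lt = zero , (λ _ ()) , lt

  LexLt-tail : {k : ℕ} {u v : Fin (suc k) → A} → u zero ≈ v zero →
               LexLt _≈_ _≺_ (tail u) (tail v) → LexLt _≈_ _≺_ u v
  LexLt-tail {u = u} {v} eq (i , eqs , lt) = suc i , earlier , lt
    where
    earlier : ∀ j → j < suc i → u j ≈ v j
    earlier zero    _         = eq
    earlier (suc j) (s≤s j<i) = eqs j j<i

  LexLe⊎LexLt : Symmetric _≈_ → Trichotomous _≈_ _≺_ →
                {k : ℕ} (u v : Fin k → A) → LexLe _≈_ _≺_ u v ⊎ LexLt _≈_ _≺_ v u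
  LexLe⊎LexLt ≈-sym compare {zero} u v = inj₁ (inj₁ λ ())
  LexLe⊎LexLt ≈-sym compare {suc k} u v with compare (u zero) (v zero)
  ... | tri< lt _ _ = inj₁ (inj₂ (LexLt-head lt))
  ... | tri> _ _ gt = inj₂ (LexLt-head gt)
  ... | tri≈ _ eq _ with LexLe⊎LexLt ≈-sym compare (tail u) (tail v)
  ...   | inj₁ (inj₁ eqs) = inj₁ (inj₁ λ { zero → eq ; (suc i) → eqs i })
  ...   | inj₁ (inj₂ lt)  = inj₁ (inj₂ (LexLt-tail eq lt))
  ...   | inj₂ gt         = inj₂ (LexLt-tail (≈-sym eq) gt)

  LexLt-irrefl : Irreflexive _≈_ _≺_ → {k : ℕ} → Irreflexive (Pointwise _≈_) (LexLt _≈_ _≺_ {k})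
  LexLt-irrefl ≺-irrefl eqs (i , _ , lt) = ≺-irrefl (eqs i) lt

  module _ (≈-sym : Symmetric _≈_) (≺-irrefl : Irreflexive _≈_ _≺_) (≺-asym : Asymmetric _≺_) where

    LexLt-asym : {k : ℕ} → Asymmetric (LexLt _≈_ _≺_ {k})
    LexLt-asym (i , eqs , lt) (i′ , eqs′ , lt′) with <-cmp i i′
    ... | tri< i<i′ _ _ = ≺-irrefl (≈-sym (eqs′ i i<i′)) lt
    ... | tri≈ _ refl _ = ≺-asym lt lt′
    ... | tri> _ _ i′<i = ≺-irrefl (≈-sym (eqs i′ i′<i)) lt′

    LexLe⇒≯ : {k : ℕ} {u v : Fin k → A} → LexLe _≈_ _≺_ u v → ¬ LexLt _≈_ _≺_ v u
    LexLe⇒≯ (inj₁ eqs) = LexLt-irrefl ≺-irrefl (≈-sym ∘ eqs)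
    LexLe⇒≯ (inj₂ lt)  = LexLt-asym lt

≤lex⊎>lex : {k : ℕ} (u v : Vecℤ k) → u ≤lex v ⊎ v <lex u
≤lex⊎>lex = LexLe⊎LexLt sym ℤ.<-cmp

<lex-irrefl : {k : ℕ} → Irreflexive (_≡v_ {k}) _<lex_
<lex-irrefl = LexLt-irrefl {_≈_ = _≡_} {_≺_ = _<ℤ_} ℤ.<-irrefl

<lex-asym : {k : ℕ} → Asymmetric (_<lex_ {k})
<lex-asym = LexLt-asym {_≈_ = _≡_} {_≺_ = _<ℤ_} sym ℤ.<-irrefl ℤ.<-asym

≤rowlex⇒≯ : {m n : ℕ} {M N : Matrix m n} → M ≤rowlex N → ¬ LexLt _≡v_ _<lex_ N M
≤rowlex⇒≯ = LexLe⇒≯ {_≈_ = _≡v_} (λ eqs → sym ∘ eqs) <lex-irrefl <lex-asym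

module _ {n : ℕ} where

  transpose-matchˡ : (i j : Fin n) → transpose i j i ≡ j
  transpose-matchˡ i j rewrite dec-true (i ≟ i) refl = refl

  transpose-fixes : {i j b : Fin n} → b ≢ i → b ≢ j → transpose i j b ≡ b
  transpose-fixes {i} {j} {b} b≢i b≢j
    rewrite dec-false (b ≟ i) b≢i | dec-false (b ≟ j) b≢j = refl

  ∘-transpose-≗ : {A : Set} (f : Fin n → A) {i j : Fin n} → f i ≡ f j → f ∘ transpose i j ≗ f
  ∘-transpose-≗ f {i} {j} eq b with b ≟ i
  ... | yes refl = sym eq
  ... | no _ with b ≟ j
  ...   | yes refl = eq
  ...   | no _     = refl

  LexLt-∘-transpose : {A : Set} {_≺_ : A → A → Set} (u : Fin n → A) {j k : Fin n} →
                      j ≤ k → u k ≺ u j → LexLt _≡_ _≺_ (u ∘ transpose j k) u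
  LexLt-∘-transpose {_≺_ = _≺_} u {j} {k} j≤k lt = j , unchanged , first-change
    where
    unchanged : ∀ b → b < j → u (transpose j k b) ≡ u b
    unchanged b b<j = cong u (transpose-fixes (<⇒≢ b<j) (<⇒≢ (<-≤-trans b<j j≤k)))
    first-change : u (transpose j k j) ≺ u j
    first-change rewrite transpose-matchˡ j k = lt

module _ {m n : ℕ} (M : Matrix m n) where

  swapColumns : Fin n → Fin n → Matrix m n
  swapColumns j k a b = M a (transpose j k b)

  swapColumns-HEquiv : (j k : Fin n) → HEquiv M (swapColumns j k)
  swapColumns-HEquiv j k =
    Perm.id , Perm.transpose j k , (λ _ → false) , (λ _ → false) , λ _ _ → refl

  swapColumns-<rowlex : {j k : Fin n} → j ≤ k → col M k <lex col M j →
                        LexLt _≡v_ _<lex_ (swapColumns j k) M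
  swapColumns-<rowlex j≤k (i , eqs , lt) =
    i , (λ a a<i → ∘-transpose-≗ (M a) (sym (eqs a a<i)))
      , LexLt-∘-transpose {_≺_ = _<ℤ_} (M i) j≤k lt

lemma3p4 : (m n : ℕ) (M : Matrix m n) → Minimum M →
    (j k : Fin n) → j ≤ k → col M j ≤lex col M k
lemma3p4 m n M minimum j k j≤k with ≤lex⊎>lex (col M j) (col M k)
... | inj₁ ≤lex = ≤lex
... | inj₂ >lex = ⊥-elim (≤rowlex⇒≯ (minimum _ (swapColumns-HEquiv M j k))
                                    (swapColumns-<rowlex M j≤k >lex))
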